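{- Let $R$ be a Noetherian commutative ring with identity having infinitely many maximal ideals. Then $\operatorname{diam}(\Gamma_0(R))\le 2$; that is, any two distinct vertices of $\Gamma_0(R)$ are at distance at most $2$.
   Context: $\Gamma_0(R)$ is the simple graph whose vertices are the non-trivial ideals of $R$ (ideals other than $0$ and $R$), two distinct ideals $I,J$ being adjacent iff $IJ=I\cap J$. -}

module Defs where

open import Level using (Level; _⊔_; suc)
open import Algebra.Bundles using (CommutativeRing)
open import Data.Nat using (ℕ; _≤_)
open import Data.List using (List; []; _∷_; foldr; map)
open import Data.List.Relation.Unary.All using (All)
open import Data.Product using (Σ; ∃; _×_; _,_; proj₁; proj₂)
open import Data.Sum using (_⊎_)
open import Relation.Nullary using (¬_)
open import Relation.Binary.PropositionalEquality using (_≡_)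

module _ {c ℓ : Level} (R : CommutativeRing c ℓ) where
  open CommutativeRing R

  record Ideal : Set (suc (c ⊔ ℓ)) where
    field
      _∈I       : Carrier → Set (c ⊔ ℓ)
      ∈-resp-≈  : ∀ {x y} → x ≈ y → x ∈I → y ∈I
      0∈        : 0# ∈I
      +-closed  : ∀ {x y} → x ∈I → y ∈I → (x + y) ∈I
      *-closed  : ∀ r {x} → x ∈I → (r * x) ∈I

  open Ideal public

  Subset : Set (suc (c ⊔ ℓ))
  Subset = Carrier → Set (c ⊔ ℓ)

  _⊆_ : Subset → Subset → Set (c ⊔ ℓ)
  A ⊆ B = ∀ x → A x → B x

  _≐_ : Subset → Subset → Set (c ⊔ ℓ)
  A ≐ B = (A ⊆ B) × (B ⊆ A)

  _⊆ᴵ_ : Ideal → Ideal → Set (c ⊔ ℓ)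
  I ⊆ᴵ J = (I ∈I) ⊆ (J ∈I)

  _≐ᴵ_ : Ideal → Ideal → Set (c ⊔ ℓ)
  I ≐ᴵ J = (I ∈I) ≐ (J ∈I)

  _∩_ : Ideal → Ideal → Subset
  (I ∩ J) x = (I ∈I) x × (J ∈I) x

  -- Product IJ of ideals: all finite sums  Σ aᵢ bᵢ  with aᵢ ∈ I, bᵢ ∈ J.
  sumProd : List (Carrier × Carrier) → Carrier
  sumProd = foldr (λ p s → proj₁ p * proj₂ p + s) 0#

  _·_ : Ideal → Ideal → Subset
  (I · J) x = Σ (List (Carrier × Carrier)) λ ps →
                All (λ p → (I ∈I) (proj₁ p) × (J ∈I) (proj₂ p)) ps × (x ≈ sumProd ps)

  Proper : Ideal → Set (c ⊔ ℓ)
  Proper I = ¬ (I ∈I) 1#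

  NonZero : Ideal → Set (c ⊔ ℓ)
  NonZero I = ¬ (∀ x → (I ∈I) x → x ≈ 0#)

  NonTrivial : Ideal → Set (c ⊔ ℓ)
  NonTrivial I = NonZero I × Proper I

  Maximal : Ideal → Set (suc (c ⊔ ℓ))
  Maximal M = Proper M × (∀ (J : Ideal) → M ⊆ᴵ J → (J ⊆ᴵ M) ⊎ (J ∈I) 1#)

  InfinitelyManyMaximal : Set (suc (c ⊔ ℓ))
  InfinitelyManyMaximal =
    Σ (ℕ → Ideal) λ M → (∀ n → Maximal (M n))
                       × (∀ m n → ¬ (m ≡ n) → ¬ (M m ≐ᴵ M n))

  Noetherian : Set (suc (c ⊔ ℓ))
  Noetherian = ∀ (I : ℕ → Ideal) → (∀ n → I n ⊆ᴵ I (ℕ.suc n))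
               → ∃ λ N → ∀ m → N ≤ m → I m ⊆ᴵ I N

  -- The graph Γ₀(R): vertices are non-trivial ideals (up to equality as sets),
  -- distinct I, J adjacent iff IJ = I ∩ J.
  Adjacent : Ideal → Ideal → Set (c ⊔ ℓ)
  Adjacent I J = ¬ (I ≐ᴵ J) × ((I · J) ≐ (I ∩ J))

  DiamAtMost2 : Set (suc (c ⊔ ℓ))
  DiamAtMost2 = ∀ (I J : Ideal) → NonTrivial I → NonTrivial J → ¬ (I ≐ᴵ J)
              → Adjacent I J ⊎ (Σ Ideal λ K → NonTrivial K × Adjacent I K × Adjacent K J)

module Submission where

-- Given non-trivial ideals I and J we find an element a,
-- lying in some maximal ideal, that is a non-zero-divisor modulo both I and J.
-- Then K = (a) is a non-trivial ideal with I ∩ K = IK and K ∩ J = KJ, so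
-- I — K — J is a path in Γ₀(R).

open import Defs
open import Level using (Level; _⊔_)
open import Algebra.Bundles using (CommutativeRing)
open import Data.Nat using (ℕ; zero; suc; _≤_)
open import Data.Nat.Properties using (≤-refl; ≤-trans; n≤1+n; <⇒≢)
open import Data.List using (List; []; _∷_; _++_; map)
open import Data.List.Relation.Unary.All as All using (All; []; _∷_)
open import Data.List.Relation.Unary.All.Properties using (++⁺; ++⁻ˡ; ++⁻ʳ; map⁺; All¬⇒¬Any)
open import Data.List.Relation.Unary.Any using (Any; here)
open import Data.List.Relation.Unary.Any.Properties using (++⁺ˡ; ++⁺ʳ)
open import Data.Product using (Σ; _×_; _,_; proj₁; proj₂; swap)
open import Data.Sum using (_⊎_; inj₁; inj₂)
open import Data.Empty using (⊥-elim)
open import Relation.Nullary using (¬_)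
open import Relation.Binary.PropositionalEquality using (_≡_)

module Theory {c ℓ : Level} (R : CommutativeRing c ℓ) where
  open CommutativeRing R
  open import Algebra.Properties.Ring ring using (-1*x≈-x)
  open import Algebra.Properties.AbelianGroup +-abelianGroup using (xyx⁻¹≈y)

  Id : Set (Level.suc (c ⊔ ℓ))
  Id = Ideal R

  _∋_ : Id → Carrier → Set (c ⊔ ℓ)
  L ∋ x = (L ∈I) x

  _⊑_ : Id → Id → Set (c ⊔ ℓ)
  I ⊑ J = _⊆ᴵ_ R I J

  cancelʳ-∈ : (L : Id) {u v : Carrier} → L ∋ (u + v) → L ∋ v → L ∋ u
  cancelʳ-∈ L {u} {v} u+v∈L v∈L =
    ∈-resp-≈ L (xyx⁻¹≈y v u)
      (+-closed L (∈-resp-≈ L (+-comm u v) u+v∈L) (∈-resp-≈ L (-1*x≈-x v) (*-closed L (- 1#) v∈L)))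

  cancelˡ-∈ : (L : Id) {u v : Carrier} → L ∋ (u + v) → L ∋ u → L ∋ v
  cancelˡ-∈ L {u} {v} u+v∈L = cancelʳ-∈ L (∈-resp-≈ L (+-comm u v) u+v∈L)

  *-closedʳ : (L : Id) {x : Carrier} (y : Carrier) → L ∋ x → L ∋ (x * y)
  *-closedʳ L {x} y x∈L = ∈-resp-≈ L (*-comm y x) (*-closed L y x∈L)

  sumProd-∈ : (L : Id) (ps : List (Carrier × Carrier)) →
              All (λ p → L ∋ (proj₁ p * proj₂ p)) ps → L ∋ sumProd R ps
  sumProd-∈ L []       []       = 0∈ L
  sumProd-∈ L (_ ∷ ps) (h ∷ hs) = +-closed L h (sumProd-∈ L ps hs)

  colon : Id → Carrier → Id
  colon L y = record
    { _∈I      = λ r → L ∋ (r * y)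
    ; ∈-resp-≈ = λ r≈s → ∈-resp-≈ L (*-congʳ r≈s)
    ; 0∈       = ∈-resp-≈ L (sym (zeroˡ y)) (0∈ L)
    ; +-closed = λ {r} {s} ry∈L sy∈L → ∈-resp-≈ L (sym (distribʳ y r s)) (+-closed L ry∈L sy∈L)
    ; *-closed = λ t {r} ry∈L → ∈-resp-≈ L (sym (*-assoc t r y)) (*-closed L t ry∈L)
    }

  adjoin : Id → Carrier → Id
  adjoin L y = record
    { _∈I      = λ z → Σ Carrier λ l → Σ Carrier λ r → L ∋ l × (z ≈ l + r * y)
    ; ∈-resp-≈ = λ { z≈w (l , r , l∈L , z≈) → l , r , l∈L , trans (sym z≈w) z≈ }
    ; 0∈       = 0# , 0# , 0∈ L , sym (trans (+-identityˡ _) (zeroˡ y))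
    ; +-closed = λ { (l , r , l∈L , z≈) (l′ , r′ , l′∈L , z′≈) →
        l + l′ , r + r′ , +-closed L l∈L l′∈L ,
        trans (+-cong z≈ z′≈)
          (trans (interchange l (r * y) l′ (r′ * y)) (+-congˡ (sym (distribʳ y r r′)))) }
    ; *-closed = λ { t (l , r , l∈L , z≈) →
        t * l , t * r , *-closed L t l∈L ,
        trans (*-congˡ z≈) (trans (distribˡ t l (r * y)) (+-congˡ (sym (*-assoc t r y)))) }
    }
    where
    interchange : ∀ a b c′ d → (a + b) + (c′ + d) ≈ (a + c′) + (b + d)
    interchange a b c′ d =
      trans (+-assoc a b (c′ + d))
        (trans (+-congˡ (trans (sym (+-assoc b c′ d))
                          (trans (+-congʳ (+-comm b c′)) (+-assoc c′ b d))))
          (sym (+-assoc a c′ (b + d))))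

  adjoin-⊒ : (L : Id) (y : Carrier) → L ⊑ adjoin L y
  adjoin-⊒ L y x x∈L = x , 0# , x∈L , sym (trans (+-congˡ (zeroˡ y)) (+-identityʳ x))

  adjoin-∋ : (L : Id) (y : Carrier) → adjoin L y ∋ y
  adjoin-∋ L y = 0# , 1# , 0∈ L , sym (trans (+-identityˡ _) (*-identityˡ y))

  principal : Carrier → Id
  principal a = record
    { _∈I      = λ z → Σ Carrier λ r → z ≈ r * a
    ; ∈-resp-≈ = λ { z≈w (r , z≈) → r , trans (sym z≈w) z≈ }
    ; 0∈       = 0# , sym (zeroˡ a)
    ; +-closed = λ { (r , z≈) (s , w≈) → r + s , trans (+-cong z≈ w≈) (sym (distribʳ a r s)) }
    ; *-closed = λ { t (r , z≈) → t * r , trans (*-congˡ z≈) (sym (*-assoc t r a)) }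
    }

  principal-∋ : (a : Carrier) → principal a ∋ a
  principal-∋ a = 1# , sym (*-identityˡ a)

  principal-proper : (M : Id) {a : Carrier} → Proper R M → M ∋ a → Proper R (principal a)
  principal-proper M M-proper a∈M (r , 1≈ra) = M-proper (∈-resp-≈ M (sym 1≈ra) (*-closed M r a∈M))

  principal-nonzero : (I : Id) {a : Carrier} → ¬ I ∋ a → NonZero R (principal a)
  principal-nonzero I {a} a∉I allZero = a∉I (∈-resp-≈ I (sym (allZero a (principal-∋ a))) (0∈ I))

  Regular : Id → Carrier → Set (c ⊔ ℓ)
  Regular L a = ∀ y → L ∋ (a * y) → L ∋ y

  regular-∉ : (L : Id) {a : Carrier} → Proper R L → Regular L a → ¬ L ∋ a
  regular-∉ L {a} L-proper regular a∈L =
    L-proper (regular 1# (∈-resp-≈ L (sym (*-identityʳ a)) a∈L))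

  product⊆intersection : (I J : Id) → _⊆_ R (_·_ R I J) (_∩_ R I J)
  product⊆intersection I J x (ps , hs , x≈) =
    ∈-resp-≈ I (sym x≈) (sumProd-∈ I ps (All.map (λ {p} h → *-closedʳ I (proj₂ p) (proj₁ h)) hs)) ,
    ∈-resp-≈ J (sym x≈) (sumProd-∈ J ps (All.map (λ {p} h → *-closed J (proj₁ p) (proj₂ h)) hs))

  -- If a is regular modulo I then I ∩ (a) ⊆ I(a): r a ∈ I forces r ∈ I.
  intersection⊆product : (I : Id) {a : Carrier} → Regular I a →
                         _⊆_ R (_∩_ R I (principal a)) (_·_ R I (principal a))
  intersection⊆product I {a} regular x (x∈I , r , x≈ra) =
    (r , a) ∷ [] ,
    (regular r (∈-resp-≈ I (trans x≈ra (*-comm r a)) x∈I) , principal-∋ a) ∷ [] ,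
    trans x≈ra (sym (+-identityʳ _))

  sumProd-swap : (ps : List (Carrier × Carrier)) → sumProd R ps ≈ sumProd R (map swap ps)
  sumProd-swap []             = refl
  sumProd-swap ((a , b) ∷ ps) = +-cong (*-comm a b) (sumProd-swap ps)

  product-comm : (I J : Id) → _⊆_ R (_·_ R I J) (_·_ R J I)
  product-comm I J x (ps , hs , x≈) =
    map swap ps , map⁺ (All.map swap hs) , trans x≈ (sumProd-swap ps)

  adjacent-sym : (I J : Id) → Adjacent R I J → Adjacent R J I
  adjacent-sym I J (I≠J , IJ⊆I∩J , I∩J⊆IJ) =
    (λ J≐I → I≠J (swap J≐I)) ,
    (λ x x∈JI → swap (IJ⊆I∩J x (product-comm J I x x∈JI))) ,
    (λ x x∈J∩I → product-comm I J x (I∩J⊆IJ x (swap x∈J∩I)))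

  regular⇒adjacent : (I : Id) {a : Carrier} → Proper R I → Regular I a →
                     Adjacent R I (principal a)
  regular⇒adjacent I {a} I-proper regular =
    (λ I≐K → regular-∉ I I-proper regular (proj₂ I≐K a (principal-∋ a))) ,
    product⊆intersection I (principal a) ,
    intersection⊆product I regular

  IsPrime : Id → Set (c ⊔ ℓ)
  IsPrime P = Proper R P × (∀ a b → P ∋ (a * b) → P ∋ a ⊎ P ∋ b)

  maximal-⊑-proper : (M P : Id) → Maximal R M → Proper R P → M ⊑ P → P ⊑ M
  maximal-⊑-proper M P (_ , maximality) P-proper M⊑P with maximality P M⊑P
  ... | inj₁ P⊑M = P⊑M
  ... | inj₂ 1∈P = ⊥-elim (P-proper 1∈P)

  adjoin-zeroDivisor : (L : Id) (y : Carrier) → IsPrime (colon L y) →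
                       ∀ a z → adjoin L y ∋ z → L ∋ (a * z) → ¬ L ∋ z → colon L y ∋ a
  adjoin-zeroDivisor L y (_ , prime) a z (l , r , l∈L , z≈) az∈L z∉L
    with prime a r (cancelˡ-∈ L (∈-resp-≈ L az≈ az∈L) (*-closed L a l∈L))
    where
    az≈ : a * z ≈ a * l + (a * r) * y
    az≈ = trans (*-congˡ z≈) (trans (distribˡ a l (r * y)) (+-congˡ (sym (*-assoc a r y))))
  ... | inj₁ ay∈L = ay∈L
  ... | inj₂ ry∈L = ⊥-elim (z∉L (∈-resp-≈ L (sym z≈) (+-closed L l∈L ry∈L)))

  stabilises : Noetherian R → (I : ℕ → Id) → (∀ n → I n ⊑ I (suc n)) →
               Σ ℕ λ N → I (suc N) ⊑ I N
  stabilises noetherian I ascending with noetherian I ascending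
  ... | N , stationary = N , stationary (suc N) (n≤1+n N)

  ExcludedMiddle : Set (Level.suc (c ⊔ ℓ))
  ExcludedMiddle = (P : Set (c ⊔ ℓ)) → P ⊎ ¬ P

  -- Maximality in Defs is a classical statement: comparing M with the ideal
  -- M + (R if P holds) decides P.
  maximal⇒excludedMiddle : (M : Id) → Maximal R M → ExcludedMiddle
  maximal⇒excludedMiddle M (M-proper , maximality) P with maximality M+P (λ _ → inj₁)
    where
    M+P : Id
    M+P = record
      { _∈I      = λ x → M ∋ x ⊎ P
      ; ∈-resp-≈ = λ { x≈y (inj₁ x∈M) → inj₁ (∈-resp-≈ M x≈y x∈M) ; _ (inj₂ p) → inj₂ p }
      ; 0∈       = inj₁ (0∈ M)
      ; +-closed = λ { (inj₁ x∈M) (inj₁ y∈M) → inj₁ (+-closed M x∈M y∈M)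
                     ; (inj₂ p) _ → inj₂ p
                     ; (inj₁ _) (inj₂ p) → inj₂ p }
      ; *-closed = λ { r (inj₁ x∈M) → inj₁ (*-closed M r x∈M) ; _ (inj₂ p) → inj₂ p }
      }
  ... | inj₁ M+P⊑M       = inj₂ (λ p → M-proper (M+P⊑M 1# (inj₂ p)))
  ... | inj₂ (inj₁ 1∈M) = ⊥-elim (M-proper 1∈M)
  ... | inj₂ (inj₂ p)   = inj₁ p

  module Classical (lem : ExcludedMiddle) where

    ¬¬-elim : {P : Set (c ⊔ ℓ)} → ¬ ¬ P → P
    ¬¬-elim {P} ¬¬p with lem P
    ... | inj₁ p  = p
    ... | inj₂ ¬p = ⊥-elim (¬¬p ¬p)

    ⋢⇒witness : (Q P : Id) → ¬ Q ⊑ P → Σ Carrier λ x → Q ∋ x × ¬ P ∋ x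
    ⋢⇒witness Q P Q⋢P = ¬¬-elim λ none → Q⋢P λ x x∈Q → ¬¬-elim λ x∉P → none (x , x∈Q , x∉P)

    outsidePrimeInsideOthers : (P : Id) → IsPrime P → (Qs : List Id) →
                               Σ Carrier λ q → ¬ P ∋ q × All (λ Q → Q ⊑ P ⊎ Q ∋ q) Qs
    outsidePrimeInsideOthers P (P-proper , _) [] = 1# , P-proper , []
    outsidePrimeInsideOthers P P-prime@(_ , prime) (Q ∷ Qs)
      with outsidePrimeInsideOthers P P-prime Qs | lem (Q ⊑ P)
    ... | q , q∉P , qs | inj₁ Q⊑P = q , q∉P , inj₁ Q⊑P ∷ qs
    ... | q , q∉P , qs | inj₂ Q⋢P with ⋢⇒witness Q P Q⋢P
    ...   | x , x∈Q , x∉P = x * q , xq∉P , inj₂ (*-closedʳ Q q x∈Q) ∷ All.map (λ {Q′} → extend {Q′}) qs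
      where
      xq∉P : ¬ P ∋ (x * q)
      xq∉P xq∈P with prime x q xq∈P
      ... | inj₁ x∈P = x∉P x∈P
      ... | inj₂ q∈P = q∉P q∈P
      extend : {Q′ : Id} → Q′ ⊑ P ⊎ Q′ ∋ q → Q′ ⊑ P ⊎ Q′ ∋ (x * q)
      extend (inj₁ Q′⊑P)      = inj₁ Q′⊑P
      extend {Q′} (inj₂ q∈Q′) = inj₂ (*-closed Q′ x q∈Q′)

    primeAvoidance : (M : Id) (Ps : List Id) → All IsPrime Ps → All (λ P → ¬ M ⊑ P) Ps →
                     Σ Carrier λ a → M ∋ a × All (λ P → ¬ P ∋ a) Ps
    primeAvoidance M [] _ _ = 0# , 0∈ M , []
    primeAvoidance M (P ∷ Qs) (P-prime ∷ Qs-prime) (M⋢P ∷ M⋢Qs)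
      with primeAvoidance M Qs Qs-prime M⋢Qs
    ... | a , a∈M , a∉Qs with lem (P ∋ a)
    ...   | inj₂ a∉P = a , a∈M , a∉P ∷ a∉Qs
    ...   | inj₁ a∈P with ⋢⇒witness M P M⋢P | outsidePrimeInsideOthers P P-prime Qs
    ...     | m , m∈M , m∉P | q , q∉P , qs =
              a + m * q , +-closed M a∈M (*-closedʳ M q m∈M) , b∉P ∷ avoidRest Qs a∉Qs qs
      where
      b∉P : ¬ P ∋ (a + m * q)
      b∉P b∈P with proj₂ P-prime m q (cancelˡ-∈ P b∈P a∈P)
      ... | inj₁ m∈P = m∉P m∈P
      ... | inj₂ q∈P = q∉P q∈P
      avoidRest : (Rs : List Id) → All (λ Q → ¬ Q ∋ a) Rs → All (λ Q → Q ⊑ P ⊎ Q ∋ q) Rs →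
                  All (λ Q → ¬ Q ∋ (a + m * q)) Rs
      avoidRest [] [] [] = []
      avoidRest (Q ∷ Rs) (_ ∷ a∉Rs) (inj₁ Q⊑P ∷ rs) =
        (λ b∈Q → b∉P (Q⊑P _ b∈Q)) ∷ avoidRest Rs a∉Rs rs
      avoidRest (Q ∷ Rs) (a∉Q ∷ a∉Rs) (inj₂ q∈Q ∷ rs) =
        (λ b∈Q → a∉Q (cancelʳ-∈ Q b∈Q (*-closed Q m q∈Q))) ∷ avoidRest Rs a∉Rs rs

    -- Pigeonhole: each prime contains at most one of pairwise distinct maximal
    -- ideals, so beyond any bound some M n lies in none of finitely many primes.
    maximalOutsidePrimes : (M : ℕ → Id) → (∀ n → Maximal R (M n)) →
                           (∀ m n → ¬ m ≡ n → ¬ _≐ᴵ_ R (M m) (M n)) →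
                           (Ps : List Id) → All IsPrime Ps → ∀ B →
                           Σ ℕ λ n → B ≤ n × All (λ P → ¬ M n ⊑ P) Ps
    maximalOutsidePrimes M maximal distinct [] _ B = B , ≤-refl , []
    maximalOutsidePrimes M maximal distinct (P ∷ Qs) (P-prime ∷ Qs-prime) B
      with maximalOutsidePrimes M maximal distinct Qs Qs-prime B
    ... | n , B≤n , Mn⋢Qs with lem (M n ⊑ P)
    ...   | inj₂ Mn⋢P = n , B≤n , Mn⋢P ∷ Mn⋢Qs
    ...   | inj₁ Mn⊑P with maximalOutsidePrimes M maximal distinct Qs Qs-prime (suc n)
    ...     | n′ , n<n′ , Mn′⋢Qs with lem (M n′ ⊑ P)
    ...       | inj₂ Mn′⋢P = n′ , ≤-trans B≤n (≤-trans (n≤1+n n) n<n′) , Mn′⋢P ∷ Mn′⋢Qs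
    ...       | inj₁ Mn′⊑P = ⊥-elim (distinct n n′ (<⇒≢ n<n′) (Mn⊑Mn′ , Mn′⊑Mn))
      where
      P⊑M : ∀ k → M k ⊑ P → P ⊑ M k
      P⊑M k = maximal-⊑-proper (M k) P (maximal k) (proj₁ P-prime)
      Mn⊑Mn′ : M n ⊑ M n′
      Mn⊑Mn′ x x∈Mn = P⊑M n′ Mn′⊑P x (Mn⊑P x x∈Mn)
      Mn′⊑Mn : M n′ ⊑ M n
      Mn′⊑Mn x x∈Mn′ = P⊑M n Mn⊑P x (Mn′⊑P x x∈Mn′)

    MaximalAnnihilator : Id → Carrier → Set (c ⊔ ℓ)
    MaximalAnnihilator L y =
      ¬ L ∋ y × (∀ z → ¬ L ∋ z → colon L y ⊑ colon L z → colon L z ⊑ colon L y)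

    -- Maximal annihilators are prime: if ab ∈ (L : y) and a ∉ (L : y), then
    -- (L : y) ⊆ (L : ay) and maximality gives b ∈ (L : ay) ⊆ (L : y).
    maximalAnnihilator-prime : (L : Id) (y : Carrier) → MaximalAnnihilator L y →
                               IsPrime (colon L y)
    maximalAnnihilator-prime L y (y∉L , maximality) =
      (λ 1y∈L → y∉L (∈-resp-≈ L (*-identityˡ y) 1y∈L)) , prime
      where
      prime : ∀ a b → L ∋ ((a * b) * y) → L ∋ (a * y) ⊎ L ∋ (b * y)
      prime a b aby∈L with lem (L ∋ (a * y))
      ... | inj₁ ay∈L = inj₁ ay∈L
      ... | inj₂ ay∉L = inj₂ (maximality (a * y) ay∉L enlarge b b∈L:ay)
        where
        enlarge : colon L y ⊑ colon L (a * y)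
        enlarge r ry∈L = ∈-resp-≈ L
          (trans (sym (*-assoc a r y)) (trans (*-congʳ (*-comm a r)) (*-assoc r a y)))
          (*-closed L a ry∈L)
        b∈L:ay : L ∋ (b * (a * y))
        b∈L:ay = ∈-resp-≈ L (trans (*-congʳ (*-comm a b)) (*-assoc b a y)) aby∈L

    module Noetherian-Ring (noetherian : Noetherian R) where

      -- A proper ideal has a maximal annihilator: otherwise the colon ideals
      -- would form a strictly ascending chain.
      maximalAnnihilator-exists : (L : Id) → Proper R L → Σ Carrier (MaximalAnnihilator L)
      maximalAnnihilator-exists L L-proper with lem (Σ Carrier (MaximalAnnihilator L))
      ... | inj₁ found = found
      ... | inj₂ none  = ⊥-elim (strict (proj₁ stop) (proj₂ stop))
        where
        Outside : Set (c ⊔ ℓ)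
        Outside = Σ Carrier λ y → ¬ L ∋ y
        Larger : Outside → Outside → Set (c ⊔ ℓ)
        Larger (y , _) (z , _) = colon L y ⊑ colon L z × ¬ colon L z ⊑ colon L y
        larger : (y : Outside) → Σ Outside (Larger y)
        larger (y , y∉L) = ¬¬-elim λ noLarger →
          none (y , y∉L , λ z z∉L inc → ¬¬-elim λ ¬back → noLarger ((z , z∉L) , inc , ¬back))
        sequence : ℕ → Outside
        sequence zero    = 1# , L-proper
        sequence (suc n) = proj₁ (larger (sequence n))
        chain : ℕ → Id
        chain n = colon L (proj₁ (sequence n))
        ascending : ∀ n → chain n ⊑ chain (suc n)
        ascending n = proj₁ (proj₂ (larger (sequence n)))
        strict : ∀ n → ¬ chain (suc n) ⊑ chain n
        strict n = proj₂ (proj₂ (larger (sequence n)))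
        stop : Σ ℕ λ N → chain (suc N) ⊑ chain N
        stop = stabilises noetherian chain ascending

      -- One step of the filtration of R / L: stop when L = R, otherwise adjoin an
      -- element y ∉ L with (L : y) prime.
      data Step (L : Id) : Set (c ⊔ ℓ) where
        finished    : L ∋ 1# → Step L
        adjoinPrime : (y : Carrier) → ¬ L ∋ y → IsPrime (colon L y) → Step L

      step : (L : Id) → Step L
      step L with lem (L ∋ 1#)
      ... | inj₁ 1∈L = finished 1∈L
      ... | inj₂ 1∉L with maximalAnnihilator-exists L 1∉L
      ...   | y , annihilator =
                adjoinPrime y (proj₁ annihilator) (maximalAnnihilator-prime L y annihilator)

      next : (L : Id) → Step L → Id
      next L (finished _)        = L
      next L (adjoinPrime y _ _) = adjoin L y

      stepPrimes : {L : Id} → Step L → List Id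
      stepPrimes (finished _)            = []
      stepPrimes {L} (adjoinPrime y _ _) = colon L y ∷ []

      next-⊒ : (L : Id) (s : Step L) → L ⊑ next L s
      next-⊒ L (finished _)        _ x∈L = x∈L
      next-⊒ L (adjoinPrime y _ _)       = adjoin-⊒ L y

      next-stationary : (L : Id) (s : Step L) → next L s ⊑ L → L ∋ 1#
      next-stationary L (finished 1∈L)        _      = 1∈L
      next-stationary L (adjoinPrime y y∉L _) grown⊑L = ⊥-elim (y∉L (grown⊑L y (adjoin-∋ L y)))

      stepPrimes-prime : {L : Id} (s : Step L) → All IsPrime (stepPrimes s)
      stepPrimes-prime (finished _)              = []
      stepPrimes-prime (adjoinPrime _ _ prime) = prime ∷ []

      stepPrimes-cover : (L : Id) (s : Step L) → ∀ a z → next L s ∋ z → L ∋ (a * z) → ¬ L ∋ z →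
                         Any (λ P → P ∋ a) (stepPrimes s)
      stepPrimes-cover L (finished _)            a z z∈L _ z∉L = ⊥-elim (z∉L z∈L)
      stepPrimes-cover L (adjoinPrime y _ prime) a z z∈L+y az∈L z∉L =
        here (adjoin-zeroDivisor L y prime a z z∈L+y az∈L z∉L)

      module Filtration (I : Id) where
        chain : ℕ → Id
        chain zero    = I
        chain (suc k) = next (chain k) (step (chain k))

        primes : ℕ → List Id
        primes zero    = []
        primes (suc k) = stepPrimes (step (chain k)) ++ primes k

        I⊑chain : ∀ k → I ⊑ chain k
        I⊑chain zero    _ x∈I = x∈I
        I⊑chain (suc k) x x∈I = next-⊒ (chain k) (step (chain k)) x (I⊑chain k x x∈I)

        primes-prime : ∀ k → All IsPrime (primes k)
        primes-prime zero    = []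
        primes-prime (suc k) = ++⁺ (stepPrimes-prime (step (chain k))) (primes-prime k)

        -- A zero-divisor a modulo I killing some z ∈ Lₖ ∖ I lies in one of the
        -- first k primes: look at the step where z enters the chain.
        primes-cover : ∀ k a z → chain k ∋ z → I ∋ (a * z) → ¬ I ∋ z →
                       Any (λ P → P ∋ a) (primes k)
        primes-cover zero    a z z∈I _    z∉I = ⊥-elim (z∉I z∈I)
        primes-cover (suc k) a z z∈Lₖ₊₁ az∈I z∉I with lem (chain k ∋ z)
        ... | inj₁ z∈Lₖ = ++⁺ʳ (stepPrimes (step (chain k))) (primes-cover k a z z∈Lₖ az∈I z∉I)
        ... | inj₂ z∉Lₖ = ++⁺ˡ (stepPrimes-cover (chain k) (step (chain k)) a z z∈Lₖ₊₁
                                                  (I⊑chain k _ az∈I) z∉Lₖ)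

      zeroDivisorPrimes : (I : Id) → Σ (List Id) λ Ps → All IsPrime Ps ×
                          (∀ a → All (λ P → ¬ P ∋ a) Ps → Regular I a)
      zeroDivisorPrimes I = primes N , primes-prime N , regular
        where
        open Filtration I
        ascending : ∀ k → chain k ⊑ chain (suc k)
        ascending k = next-⊒ (chain k) (step (chain k))
        stop : Σ ℕ λ N → chain (suc N) ⊑ chain N
        stop = stabilises noetherian chain ascending
        N : ℕ
        N = proj₁ stop
        1∈L : chain N ∋ 1#
        1∈L = next-stationary (chain N) (step (chain N)) (proj₂ stop)
        regular : ∀ a → All (λ P → ¬ P ∋ a) (primes N) → Regular I a
        regular a a∉Ps z az∈I with lem (I ∋ z)
        ... | inj₁ z∈I = z∈I
        ... | inj₂ z∉I = ⊥-elim (All¬⇒¬Any a∉Ps (primes-cover N a z z∈L az∈I z∉I))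
          where
          z∈L : chain N ∋ z
          z∈L = ∈-resp-≈ (chain N) (*-identityʳ z) (*-closed (chain N) z 1∈L)

      regularInMaximal : InfinitelyManyMaximal R → (I J : Id) →
                         Σ Carrier λ a → Σ Id (λ M → Maximal R M × M ∋ a) × Regular I a × Regular J a
      regularInMaximal (M , maximal , distinct) I J
        with zeroDivisorPrimes I | zeroDivisorPrimes J
      ... | PsI , PsI-prime , regularI | PsJ , PsJ-prime , regularJ
        with maximalOutsidePrimes M maximal distinct (PsI ++ PsJ) (++⁺ PsI-prime PsJ-prime) 0
      ... | n , _ , Mn⋢Ps with primeAvoidance (M n) (PsI ++ PsJ) (++⁺ PsI-prime PsJ-prime) Mn⋢Ps
      ... | a , a∈Mn , a∉Ps =
        a , (M n , maximal n , a∈Mn) , regularI a (++⁻ˡ PsI a∉Ps) , regularJ a (++⁻ʳ PsI a∉Ps)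

  diameterAtMostTwo : Noetherian R → InfinitelyManyMaximal R → DiamAtMost2 R
  diameterAtMostTwo noetherian infinite@(M , maximal , _) I J (_ , I-proper) (_ , J-proper) _
    with Classical.Noetherian-Ring.regularInMaximal (maximal⇒excludedMiddle (M 0) (maximal 0))
                                                   noetherian infinite I J
  ... | a , (Mₐ , (Mₐ-proper , _) , a∈Mₐ) , regularI , regularJ =
    inj₂ (principal a ,
          (principal-nonzero I (regular-∉ I I-proper regularI) , principal-proper Mₐ Mₐ-proper a∈Mₐ) ,
          regular⇒adjacent I I-proper regularI ,
          adjacent-sym J (principal a) (regular⇒adjacent J J-proper regularJ))

mainTheorem12 : ∀ {c ℓ : Level} (R : CommutativeRing c ℓ) → Noetherian R → InfinitelyManyMaximal R → DiamAtMost2 R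
mainTheorem12 R = Theory.diameterAtMostTwo R
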